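{- Let $w_1,\ldots,w_s$ be positive integers, let $G$ be the weighted line graph they define, and let $M_0,M_1,M_2,\ldots$ be a sequence of matchings produced by the Hungarian Algorithm on $G$. For any $i$ with $0\le i\le \lceil s/2\rceil-2$, there exist maximal chains $C_1$ and $C_2$ in $M_i$ (possibly empty chains) such that $$M_{i+2}=\big(M_i\setminus(C_1\cup C_2)\big)\cup\big(\mathrm{Aug}(C_1)\cup\mathrm{Aug}(C_2)\big).$$
   Context: The line graph $G$ has vertices $v_0,\ldots,v_s$ and edges $E=\{e_1,\ldots,e_s\}$ with $e_i=(v_{i-1},v_i)$ and weight $\mathrm{wt}(e_i)=w_i$. A matching is a subset $M\subseteq E$ with $|M\cap\{e_i,e_{i+1}\}|\le 1$ for each $i$; $\mathrm{wt}(M)=\sum_{e_i\in M}\mathrm{wt}(e_i)$. A chain in a matching $M$ is a set $C=\{e_i,e_{i+2},\ldots,e_{i+2c}\}\subseteq M$ for some $c\in\mathbb{N}$; it is maximal if $e_{i-2},e_{i+2c+2}\notin M$. Its augmentation is $\mathrm{Aug}(C)=\{e_{i-1},e_{i+1},\ldots,e_{i+2c+1}\}\cap E$. For $i\in[s]$, $M$ contains the $i$-th empty chain $\emptyset_i$ if $M$ contains none of $e_{i-1},e_i,e_{i+1}$; empty chains are considered maximal chains, are treated as the empty set, and $\mathrm{Aug}(\emptyset_i)=\{e_i\}$. A matching $M'$ is an augmentation of $M$ if $M'=(M\setminus C)\cup\mathrm{Aug}(C)$ for some maximal (possibly empty) chain $C$ of $M$ and $|M'|=|M|+1$. The Hungarian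 Algorithm sets $M_0=\emptyset$ and, for each $i\ge1$, lets $M_i$ be any augmentation of $M_{i-1}$ of minimum weight among all augmentations of $M_{i-1}$. -}

module Defs where

open import Data.Nat using (ℕ; zero; suc; _+_; _*_; _∸_; _≤_; _<_; _≤ᵇ_; _≡ᵇ_; _%_; ⌈_/2⌉)
open import Data.Bool using (Bool; true; false; _∧_; _∨_; not; if_then_else_)
open import Data.Product using (Σ; _×_)
open import Relation.Binary.PropositionalEquality using (_≡_)

-- Edges of the line graph are e_1,…,e_s, identified with the naturals 1..s.
-- A set of edges is its (decidable) characteristic function on ℕ.
EdgeSet : Set
EdgeSet = ℕ → Bool

∅ₑ : EdgeSet
∅ₑ _ = false

-- weights: w j = wt(e_j); only w 1 … w s are relevant.
Weights : Set
Weights = ℕ → ℕ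

wtUpTo : Weights → EdgeSet → ℕ → ℕ
wtUpTo w M zero    = 0
wtUpTo w M (suc n) = wtUpTo w M n + (if M (suc n) then w (suc n) else 0)

sizeUpTo : EdgeSet → ℕ → ℕ
sizeUpTo M zero    = 0
sizeUpTo M (suc n) = sizeUpTo M n + (if M (suc n) then 1 else 0)

-- Maximal chains of M in the line graph with s edges.
--  * chain i c : C = {e_i, e_{i+2}, …, e_{i+2c}} ⊆ M with e_{i-2}, e_{i+2c+2} ∉ M
--    (conditions about non-existent edges are vacuous);
--  * empty k   : the k-th empty chain ∅_k, k ∈ [s], with e_{k-1}, e_k, e_{k+1} ∉ M.
data MaxChain (s : ℕ) (M : EdgeSet) : Set where
  chain : (i c : ℕ) → 1 ≤ i → i + 2 * c ≤ s →
          (∀ j → j ≤ c → M (i + 2 * j) ≡ true) →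
          (2 < i → M (i ∸ 2) ≡ false) →
          (i + 2 * c + 2 ≤ s → M (i + 2 * c + 2) ≡ false) →
          MaxChain s M
  empty : (k : ℕ) → 1 ≤ k → k ≤ s →
          (2 ≤ k → M (k ∸ 1) ≡ false) →
          M k ≡ false →
          (k + 1 ≤ s → M (k + 1) ≡ false) →
          MaxChain s M

chainSet : ∀ {s M} → MaxChain s M → EdgeSet
chainSet (chain i c _ _ _ _ _) j = (i ≤ᵇ j) ∧ (j ≤ᵇ i + 2 * c) ∧ (j % 2 ≡ᵇ i % 2)
chainSet (empty k _ _ _ _ _)   j = false

-- Aug(C) = {e_{i-1}, e_{i+1}, …, e_{i+2c+1}} ∩ E ;  Aug(∅_k) = {e_k}
augSet : ∀ {s M} → MaxChain s M → EdgeSet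
augSet {s} (chain i c _ _ _ _ _) j =
  (i ≤ᵇ j + 1) ∧ (j ≤ᵇ i + 2 * c + 1) ∧ (j % 2 ≡ᵇ (i + 1) % 2) ∧ (1 ≤ᵇ j) ∧ (j ≤ᵇ s)
augSet (empty k _ _ _ _ _) j = j ≡ᵇ k

IsAugmentation : ℕ → EdgeSet → EdgeSet → Set
IsAugmentation s M M' =
  Σ (MaxChain s M) λ C →
    (∀ j → M' j ≡ ((M j ∧ not (chainSet C j)) ∨ augSet C j)) ×
    (sizeUpTo M' s ≡ sizeUpTo M s + 1)

IsHAStep : ℕ → Weights → EdgeSet → EdgeSet → Set
IsHAStep s w M M' =
  IsAugmentation s M M' ×
  (∀ M'' → IsAugmentation s M M'' → wtUpTo w M' s ≤ wtUpTo w M'' s)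

-- M₀, M₁, … is a run of the Hungarian Algorithm (for the steps 1..⌈s/2⌉,
-- i.e. until a maximum matching is reached)
IsHARun : ℕ → Weights → (ℕ → EdgeSet) → Set
IsHARun s w M =
  (∀ j → M 0 j ≡ false) ×
  (∀ k → 1 ≤ k → k ≤ ⌈ s /2⌉ → IsHAStep s w (M (k ∸ 1)) (M k))

-- A maximal chain C of a matching M and Aug(C) alternate along a path of the line graph. When the
-- augmentation (M ∖ C) ∪ Aug(C) is one edge larger than M, Aug(C) is not cut off at either end of the
-- graph, so this path is an augmenting path of M (its end vertices are not covered by M) and the
-- augmentation flips M along it.
-- Let P and P′ be the augmenting paths of the steps M_i → M_{i+1} → M_{i+2}. If no edge added along P
-- is a matched edge of P′, then P′ is already an augmenting path of M_i, disjoint from P, and M_{i+2}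
-- flips M_i along both. Otherwise, as M_{i+1} alternates along P and the ends of P′ are not covered by
-- M_{i+1}, the path P′ contains P; removing P from P′ leaves two augmenting paths of M_i, and since
-- flipping along P′ undoes P, M_{i+2} flips M_i along these two.

module Submission where

open import Defs
open import Data.Nat using (ℕ; zero; suc; _+_; _*_; _∸_; _≤_; _<_; _≤ᵇ_; _≡ᵇ_; _%_; ⌈_/2⌉; z≤n; s≤s)
open import Data.Nat.Properties
open import Data.Nat.DivMod using ([m+kn]%n≡m%n)
open import Data.Nat.Tactic.RingSolver using (solve-∀)
open import Data.Bool as Bool using (Bool; true; false; _∧_; _∨_; not; if_then_else_)
open import Data.Bool.Properties using (T-≡; ¬-not; not-injective; ∨-assoc; ∧-assoc; ∨-identityʳ; ∧-identityʳ; ∨-zeroʳ)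
open import Data.Product using (Σ; ∃-syntax; _×_; _,_; proj₁; proj₂)
open import Data.Sum using (_⊎_; inj₁; inj₂)
open import Data.Empty using (⊥; ⊥-elim)
open import Function.Bundles using (Equivalence)
open import Relation.Binary.PropositionalEquality
open import Relation.Nullary using (¬_; yes; no)

infix 4 _∈ₑ_ _∉ₑ_

_∈ₑ_ : ℕ → EdgeSet → Set
j ∈ₑ N = N j ≡ true

_∉ₑ_ : ℕ → EdgeSet → Set
j ∉ₑ N = N j ≡ false

∈∉-clash : ∀ {b} → b ≡ true → b ≡ false → ⊥
∈∉-clash p q with () ← trans (sym p) q

≡-from-⇔ : ∀ {b c} → (b ≡ true → c ≡ true) → (c ≡ true → b ≡ true) → b ≡ c
≡-from-⇔ {false} {false} _ _ = refl
≡-from-⇔ {false} {true}  _ g = g refl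
≡-from-⇔ {true}         f _ = sym (f refl)

∧-true⁻ : ∀ {a b} → (a ∧ b) ≡ true → a ≡ true × b ≡ true
∧-true⁻ {true} q = refl , q

∧-true⁺ : ∀ {a b} → a ≡ true → b ≡ true → (a ∧ b) ≡ true
∧-true⁺ refl q = q

∨-true⁺ˡ : ∀ {a b} → a ≡ true → (a ∨ b) ≡ true
∨-true⁺ˡ refl = refl

∨-true⁺ʳ : ∀ {a b} → b ≡ true → (a ∨ b) ≡ true
∨-true⁺ʳ {a} refl = ∨-zeroʳ a

∨-true⁻ : ∀ {a b} → (a ∨ b) ≡ true → a ≡ true ⊎ b ≡ true
∨-true⁻ {true}  _ = inj₁ refl
∨-true⁻ {false} q = inj₂ q

≤ᵇ-true : ∀ {m n} → m ≤ n → (m ≤ᵇ n) ≡ true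
≤ᵇ-true p = Equivalence.to T-≡ (≤⇒≤ᵇ p)

≤ᵇ-true⁻ : ∀ {m n} → (m ≤ᵇ n) ≡ true → m ≤ n
≤ᵇ-true⁻ {m} {n} q = ≤ᵇ⇒≤ m n (Equivalence.from T-≡ q)

≡ᵇ-true : ∀ {m n} → m ≡ n → (m ≡ᵇ n) ≡ true
≡ᵇ-true {m} {n} p = Equivalence.to T-≡ (≡⇒≡ᵇ m n p)

≡ᵇ-true⁻ : ∀ {m n} → (m ≡ᵇ n) ≡ true → m ≡ n
≡ᵇ-true⁻ {m} {n} q = ≡ᵇ⇒≡ m n (Equivalence.from T-≡ q)

+2*-%2 : ∀ x t → (x + 2 * t) % 2 ≡ x % 2
+2*-%2 x t = trans (cong (λ y → (x + y) % 2) (*-comm 2 t)) ([m+kn]%n≡m%n x t 2)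

suc-%2≢ : ∀ x → suc x % 2 ≢ x % 2
suc-%2≢ zero          ()
suc-%2≢ (suc zero)    ()
suc-%2≢ (suc (suc x)) eq = suc-%2≢ x eq

even-offset : ∀ x o → (x + o) % 2 ≡ x % 2 → ∃[ t ] o ≡ 2 * t
even-offset x zero          _  = 0 , refl
even-offset x (suc zero)    eq = ⊥-elim (suc-%2≢ x (trans (cong (_% 2) (+-comm 1 x)) eq))
even-offset x (suc (suc o)) eq with even-offset x o (trans (cong (_% 2) (sym x+2+o)) eq)
  where
  x+2+o : x + suc (suc o) ≡ suc (suc (x + o))
  x+2+o = trans (+-suc x (suc o)) (cong suc (+-suc x o))
... | t , refl = suc t , sym (*-suc 2 t)

even-gap : ∀ {x y} → x ≤ y → y % 2 ≡ x % 2 → ∃[ t ] y ≡ x + 2 * t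
even-gap {x} x≤y eq with m≤n⇒∃[o]m+o≡n x≤y
... | o , refl with even-offset x o eq
...   | t , refl = t , refl

a+2t≢suc : ∀ a t u → a + 2 * t ≢ suc (a + 2 * u)
a+2t≢suc a t u eq = suc-%2≢ (a + 2 * u) (trans (cong (_% 2) (sym eq)) (trans (+2*-%2 a t) (sym (+2*-%2 a u))))

everyOther : ℕ → ℕ → EdgeSet
everyOther x zero    j = false
everyOther x (suc n) j = (j ≡ᵇ x) ∨ everyOther (2 + x) n j

+2*suc : ∀ x t → x + 2 * suc t ≡ 2 + x + 2 * t
+2*suc = solve-∀

∈-everyOther⁺ : ∀ {x n t} → t < n → x + 2 * t ∈ₑ everyOther x n
∈-everyOther⁺ {x} {suc n} {zero}  _         rewrite ≡ᵇ-true {x + 0} (+-identityʳ x) = refl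
∈-everyOther⁺ {x} {suc n} {suc t} (s≤s t<n) rewrite +2*suc x t | ∈-everyOther⁺ {2 + x} t<n = ∨-zeroʳ _

∈-everyOther⁻ : ∀ {x n j} → j ∈ₑ everyOther x n → ∃[ t ] t < n × j ≡ x + 2 * t
∈-everyOther⁻ {x} {suc n} {j} j∈ with ∨-true⁻ {j ≡ᵇ x} j∈
... | inj₁ j≡x = 0 , s≤s z≤n , trans (≡ᵇ-true⁻ j≡x) (sym (+-identityʳ x))
... | inj₂ j∈′ with ∈-everyOther⁻ {2 + x} {n} {j} j∈′
...   | t , t<n , j≡ = suc t , s≤s t<n , trans j≡ (sym (+2*suc x t))

everyOther-++ : ∀ x m n j → everyOther x (m + n) j ≡ (everyOther x m j ∨ everyOther (x + 2 * m) n j)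
everyOther-++ x zero    n j = cong (λ y → everyOther y n j) (sym (+-identityʳ x))
everyOther-++ x (suc m) n j = begin
  (j ≡ᵇ x) ∨ everyOther (2 + x) (m + n) j
    ≡⟨ cong ((j ≡ᵇ x) ∨_) (everyOther-++ (2 + x) m n j) ⟩
  (j ≡ᵇ x) ∨ (everyOther (2 + x) m j ∨ everyOther (2 + x + 2 * m) n j)
    ≡⟨ sym (∨-assoc (j ≡ᵇ x) _ _) ⟩
  ((j ≡ᵇ x) ∨ everyOther (2 + x) m j) ∨ everyOther (2 + x + 2 * m) n j
    ≡⟨ cong (λ y → ((j ≡ᵇ x) ∨ everyOther (2 + x) m j) ∨ everyOther y n j) (sym (+2*suc x m)) ⟩
  ((j ≡ᵇ x) ∨ everyOther (2 + x) m j) ∨ everyOther (x + 2 * suc m) n j ∎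
  where open ≡-Reasoning

everyOther-++₃ : ∀ x m n k j →
  everyOther x (m + (n + k)) j ≡ (everyOther x m j ∨ (everyOther (x + 2 * m) n j ∨ everyOther (x + 2 * m + 2 * n) k j))
everyOther-++₃ x m n k j = trans (everyOther-++ x m (n + k) j) (cong (everyOther x m j ∨_) (everyOther-++ (x + 2 * m) n k j))

record IsMatching (s : ℕ) (N : EdgeSet) : Set where
  field
    positive : ∀ {j} → j ∈ₑ N → 1 ≤ j
    bounded  : ∀ {j} → j ∈ₑ N → j ≤ s
    disjoint : ∀ {j} → j ∈ₑ N → suc j ∉ₑ N

  disjoint⁻ : ∀ {j} → suc j ∈ₑ N → j ∉ₑ N
  disjoint⁻ sj∈ = ¬-not λ j∈ → ∈∉-clash sj∈ (disjoint j∈)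

  ∉-from-positive : ∀ {j} → (1 ≤ j → j ∉ₑ N) → j ∉ₑ N
  ∉-from-positive {zero}  _ = ¬-not λ 0∈ → <-irrefl refl (positive 0∈)
  ∉-from-positive {suc j} h = h (s≤s z≤n)

  ∉-from-bounded : ∀ {j} → (j ≤ s → j ∉ₑ N) → j ∉ₑ N
  ∉-from-bounded {j} h with j ≤? s
  ... | yes j≤s = h j≤s
  ... | no j≰s  = ¬-not λ j∈ → j≰s (bounded j∈)

open IsMatching

noEdges-isMatching : ∀ {s N} → (∀ j → N j ≡ false) → IsMatching s N
noEdges-isMatching N≡∅ = record
  { positive = λ {j} j∈ → ⊥-elim (∈∉-clash j∈ (N≡∅ j))
  ; bounded  = λ {j} j∈ → ⊥-elim (∈∉-clash j∈ (N≡∅ j))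
  ; disjoint = λ {j} _ → N≡∅ (suc j)
  }

-- The path v_a v_{a+1} … v_{a+2f+1} of the line graph: its odd edges e_{a+1}, e_{a+3}, …, e_{a+2f+1}
-- lie outside N, its even edges inside, and its end vertices are not covered by N.
record IsAugmentingPath (s : ℕ) (N : EdgeSet) (a f : ℕ) : Set where
  field
    last≤s    : suc (a + 2 * f) ≤ s
    unmatched : ∀ {t} → t ≤ f → suc (a + 2 * t) ∉ₑ N
    matched   : ∀ {t} → t < f → suc (suc (a + 2 * t)) ∈ₑ N
    exposedˡ  : a ∉ₑ N
    exposedʳ  : suc (suc (a + 2 * f)) ∉ₑ N

oddEdges : ℕ → ℕ → EdgeSet
oddEdges a f = everyOther (suc a) (suc f)

evenEdges : ℕ → ℕ → EdgeSet
evenEdges a f = everyOther (2 + a) f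

augmentAlong : EdgeSet → ℕ → ℕ → EdgeSet
augmentAlong N a f j = (N j ∧ not (evenEdges a f j)) ∨ oddEdges a f j

∈-oddEdges⁺ : ∀ {a f t} → t ≤ f → suc (a + 2 * t) ∈ₑ oddEdges a f
∈-oddEdges⁺ {a} {f} {t} t≤f = ∈-everyOther⁺ {suc a} {suc f} {t} (s≤s t≤f)

∈-oddEdges⁻ : ∀ {a f j} → j ∈ₑ oddEdges a f → ∃[ t ] t ≤ f × j ≡ suc (a + 2 * t)
∈-oddEdges⁻ {a} {f} j∈ with ∈-everyOther⁻ {suc a} {suc f} j∈
... | t , s≤s t≤f , j≡ = t , t≤f , j≡

∈-evenEdges⁺ : ∀ {a f t} → t < f → suc (suc (a + 2 * t)) ∈ₑ evenEdges a f
∈-evenEdges⁺ {a} {f} {t} = ∈-everyOther⁺ {2 + a} {f} {t}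

∈-evenEdges⁻ : ∀ {a f j} → j ∈ₑ evenEdges a f → ∃[ t ] t < f × j ≡ suc (suc (a + 2 * t))
∈-evenEdges⁻ {a} {f} = ∈-everyOther⁻ {2 + a} {f}

evenEdges⊆ : ∀ {s N a f j} → IsAugmentingPath s N a f → j ∈ₑ evenEdges a f → j ∈ₑ N
evenEdges⊆ {N = N} {a} {f} {j} P j∈ with ∈-evenEdges⁻ {a} {f} {j} j∈
... | t , t<f , j≡ = subst (_∈ₑ N) (sym j≡) (IsAugmentingPath.matched P t<f)

oddEdges∉ : ∀ {s N a f j} → IsAugmentingPath s N a f → j ∈ₑ oddEdges a f → j ∉ₑ N
oddEdges∉ {N = N} {a} {f} {j} P j∈ with ∈-oddEdges⁻ {a} {f} {j} j∈
... | t , t≤f , j≡ = subst (_∉ₑ N) (sym j≡) (IsAugmentingPath.unmatched P t≤f)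

evenEdges-next : ∀ {a f j} → j ∈ₑ evenEdges a f → suc j ∈ₑ oddEdges a f
evenEdges-next {a} {f} {j} j∈ with ∈-evenEdges⁻ {a} {f} {j} j∈
... | t , t<f , j≡ = subst (λ x → suc x ∈ₑ oddEdges a f) (trans (+2*suc a t) (sym j≡)) (∈-oddEdges⁺ {a} {f} {suc t} t<f)

evenEdges-prev : ∀ {a f j} → suc j ∈ₑ evenEdges a f → j ∈ₑ oddEdges a f
evenEdges-prev {a} {f} {j} sj∈ with ∈-evenEdges⁻ {a} {f} {suc j} sj∈
... | t , t<f , sj≡ = subst (_∈ₑ oddEdges a f) (sym (suc-injective sj≡)) (∈-oddEdges⁺ {a} {f} {t} (<⇒≤ t<f))

oddEdges-within : ∀ {a f j} → j ∈ₑ oddEdges a f → a < j × j ≤ suc (a + 2 * f)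
oddEdges-within {a} {f} {j} j∈ with ∈-oddEdges⁻ {a} {f} {j} j∈
... | t , t≤f , j≡ rewrite j≡ = s≤s (m≤m+n a (2 * t)) , s≤s (+-monoʳ-≤ a (*-monoʳ-≤ 2 t≤f))

evenEdges-within : ∀ {a f j} → j ∈ₑ evenEdges a f → a < j × j ≤ suc (a + 2 * f)
evenEdges-within {a} {f} {j} j∈ with ∈-evenEdges⁻ {a} {f} {j} j∈
... | t , t<f , j≡ rewrite j≡ =
  ≤-trans (n≤1+n _) (s≤s (s≤s (m≤m+n a (2 * t)))) ,
  ≤-trans (≤-reflexive (sym (+2*suc a t))) (≤-trans (+-monoʳ-≤ a (*-monoʳ-≤ 2 t<f)) (n≤1+n _))

oddEdges-prev : ∀ {a f j} → suc j ∈ₑ oddEdges a f → j ≡ a ⊎ j ∈ₑ evenEdges a f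
oddEdges-prev {a} {f} {j} sj∈ with ∈-oddEdges⁻ {a} {f} {suc j} sj∈
... | zero  , _        , sj≡ = inj₁ (trans (suc-injective sj≡) (+-identityʳ a))
... | suc t , st≤f , sj≡ =
  inj₂ (subst (_∈ₑ evenEdges a f) (sym (trans (suc-injective sj≡) (+2*suc a t))) (∈-evenEdges⁺ {a} {f} {t} st≤f))

oddEdges-next : ∀ {a f j} → j ∈ₑ oddEdges a f → suc j ∈ₑ evenEdges a f ⊎ j ≡ suc (a + 2 * f)
oddEdges-next {a} {f} {j} j∈ with ∈-oddEdges⁻ {a} {f} {j} j∈
... | t , t≤f , j≡ with m≤n⇒m<n∨m≡n t≤f
...   | inj₁ t<f = inj₁ (subst (λ x → suc x ∈ₑ evenEdges a f) (sym j≡) (∈-evenEdges⁺ {a} {f} {t} t<f))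
...   | inj₂ refl = inj₂ j≡

∈-augmentAlong⁻ : ∀ {N a f j} → j ∈ₑ augmentAlong N a f → (j ∈ₑ N × j ∉ₑ evenEdges a f) ⊎ j ∈ₑ oddEdges a f
∈-augmentAlong⁻ {N} {a} {f} {j} j∈ with ∨-true⁻ {N j ∧ not (evenEdges a f j)} j∈
... | inj₁ kept  = inj₁ (proj₁ (∧-true⁻ {N j} kept) , not-injective (proj₂ (∧-true⁻ {N j} kept)))
... | inj₂ added = inj₂ added

augmentAlong-outside : ∀ {N a f j} → j ≤ a ⊎ suc (a + 2 * f) < j → augmentAlong N a f j ≡ N j
augmentAlong-outside {N} {a} {f} {j} outside = begin
  (N j ∧ not (evenEdges a f j)) ∨ oddEdges a f j
    ≡⟨ cong₂ (λ x y → (N j ∧ not x) ∨ y) (absent {evenEdges a f} within-even) (absent {oddEdges a f} within-odd) ⟩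
  (N j ∧ true) ∨ false ≡⟨ ∨-identityʳ _ ⟩
  N j ∧ true           ≡⟨ ∧-identityʳ _ ⟩
  N j                  ∎
  where
  open ≡-Reasoning
  absent : ∀ {X} → (j ∈ₑ X → a < j × j ≤ suc (a + 2 * f)) → j ∉ₑ X
  absent within = ¬-not λ j∈ → case outside (within j∈)
    where
    case : j ≤ a ⊎ suc (a + 2 * f) < j → a < j × j ≤ suc (a + 2 * f) → ⊥
    case (inj₁ j≤a) (a<j , _) = <-irrefl refl (≤-trans a<j j≤a)
    case (inj₂ <j)  (_ , j≤)  = <-irrefl refl (≤-trans <j j≤)
  within-even = evenEdges-within {a} {f} {j}
  within-odd  = oddEdges-within {a} {f} {j}

evenEdges-concat : ∀ b u e v j → evenEdges b (suc (u + e) + v) j ≡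
  (evenEdges b u j ∨ (oddEdges (suc (b + 2 * u)) e j ∨ evenEdges (suc (suc (b + 2 * u) + 2 * e)) v j))
evenEdges-concat b u e v j = begin
  everyOther (2 + b) (suc (u + e) + v) j
    ≡⟨ cong (λ n → everyOther (2 + b) n j) (count≡ u e v) ⟩
  everyOther (2 + b) (u + (suc e + v)) j
    ≡⟨ everyOther-++₃ (2 + b) u (suc e) v j ⟩
  everyOther (2 + b) u j ∨ (everyOther (2 + b + 2 * u) (suc e) j ∨ everyOther (2 + b + 2 * u + 2 * suc e) v j)
    ≡⟨ cong (λ x → everyOther (2 + b) u j ∨ (everyOther (2 + b + 2 * u) (suc e) j ∨ everyOther x v j)) (start≡ b u e) ⟩
  everyOther (2 + b) u j ∨ (everyOther (2 + b + 2 * u) (suc e) j ∨ everyOther (2 + suc (suc (b + 2 * u) + 2 * e)) v j) ∎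
  where
  open ≡-Reasoning
  count≡ : ∀ u e v → suc (u + e) + v ≡ u + (suc e + v)
  count≡ = solve-∀
  start≡ : ∀ b u e → 2 + b + 2 * u + 2 * suc e ≡ 2 + suc (suc (b + 2 * u) + 2 * e)
  start≡ = solve-∀

oddEdges-concat : ∀ b u e v j → oddEdges b (suc (u + e) + v) j ≡
  (oddEdges b u j ∨ (evenEdges (suc (b + 2 * u)) e j ∨ oddEdges (suc (suc (b + 2 * u) + 2 * e)) v j))
oddEdges-concat b u e v j = begin
  everyOther (suc b) (suc (suc (u + e) + v)) j
    ≡⟨ cong (λ n → everyOther (suc b) n j) (count≡ u e v) ⟩
  everyOther (suc b) (suc u + (e + suc v)) j
    ≡⟨ everyOther-++₃ (suc b) (suc u) e (suc v) j ⟩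
  everyOther (suc b) (suc u) j ∨ (everyOther (suc b + 2 * suc u) e j ∨ everyOther (suc b + 2 * suc u + 2 * e) (suc v) j)
    ≡⟨ cong₂ (λ x y → everyOther (suc b) (suc u) j ∨ (everyOther x e j ∨ everyOther y (suc v) j)) (start≡ b u) (end≡ b u e) ⟩
  everyOther (suc b) (suc u) j ∨ (everyOther (2 + suc (b + 2 * u)) e j ∨ everyOther (suc (suc (suc (b + 2 * u) + 2 * e))) (suc v) j) ∎
  where
  open ≡-Reasoning
  count≡ : ∀ u e v → suc (suc (u + e) + v) ≡ suc u + (e + suc v)
  count≡ = solve-∀
  start≡ : ∀ b u → suc b + 2 * suc u ≡ 2 + suc (b + 2 * u)
  start≡ = solve-∀
  end≡ : ∀ b u e → suc b + 2 * suc u + 2 * e ≡ suc (suc (suc (b + 2 * u) + 2 * e))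
  end≡ = solve-∀

parityRange≡everyOther : ∀ x n j → ((x ≤ᵇ j) ∧ (j ≤ᵇ x + 2 * n) ∧ (j % 2 ≡ᵇ x % 2)) ≡ everyOther x (suc n) j
parityRange≡everyOther x n j = ≡-from-⇔ to from
  where
  inRange : ℕ → Bool
  inRange y = (x ≤ᵇ y) ∧ (y ≤ᵇ x + 2 * n) ∧ (y % 2 ≡ᵇ x % 2)
  to : inRange j ≡ true → j ∈ₑ everyOther x (suc n)
  to h with ∧-true⁻ {x ≤ᵇ j} h
  ... | x≤j , h′ with ∧-true⁻ {j ≤ᵇ x + 2 * n} h′
  ... | j≤ , par with even-gap (≤ᵇ-true⁻ {x} x≤j) (≡ᵇ-true⁻ {j % 2} par)
  ... | t , j≡ = subst (_∈ₑ everyOther x (suc n)) (sym j≡) (∈-everyOther⁺ {x} {suc n} {t} (s≤s t≤n))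
    where
    t≤n : t ≤ n
    t≤n = *-cancelˡ-≤ 2 (+-cancelˡ-≤ x _ _ (subst (_≤ x + 2 * n) j≡ (≤ᵇ-true⁻ {j} j≤)))
  from : j ∈ₑ everyOther x (suc n) → inRange j ≡ true
  from h with ∈-everyOther⁻ {x} {suc n} {j} h
  ... | t , s≤s t≤n , j≡ = subst (λ y → inRange y ≡ true) (sym j≡)
    (∧-true⁺ (≤ᵇ-true (m≤m+n x (2 * t)))
      (∧-true⁺ (≤ᵇ-true (+-monoʳ-≤ x (*-monoʳ-≤ 2 t≤n))) (≡ᵇ-true (+2*-%2 x t))))

suc-≤ᵇ-suc : ∀ m n → (suc m ≤ᵇ suc n) ≡ (m ≤ᵇ n)
suc-≤ᵇ-suc zero    n = refl
suc-≤ᵇ-suc (suc m) n = refl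

augSet-chain : ∀ {s M p c h₁ h₂ h₃ h₄ h₅} j →
  augSet (chain {s} {M} (suc p) c h₁ h₂ h₃ h₄ h₅) j ≡ (everyOther p (2 + c) j ∧ (1 ≤ᵇ j) ∧ (j ≤ᵇ s))
augSet-chain {s} {p = p} {c} j = begin
  (suc p ≤ᵇ j + 1) ∧ (j ≤ᵇ suc p + 2 * c + 1) ∧ (j % 2 ≡ᵇ (suc p + 1) % 2) ∧ R
    ≡⟨ cong₂ (λ y z → (suc p ≤ᵇ y) ∧ (j ≤ᵇ z) ∧ (j % 2 ≡ᵇ (suc p + 1) % 2) ∧ R) (+-comm j 1) (end≡ p c) ⟩
  (suc p ≤ᵇ suc j) ∧ (j ≤ᵇ p + 2 * suc c) ∧ (j % 2 ≡ᵇ (suc p + 1) % 2) ∧ R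
    ≡⟨ cong₂ (λ y z → y ∧ (j ≤ᵇ p + 2 * suc c) ∧ (j % 2 ≡ᵇ z % 2) ∧ R) (suc-≤ᵇ-suc p j) (+-comm (suc p) 1) ⟩
  (p ≤ᵇ j) ∧ (j ≤ᵇ p + 2 * suc c) ∧ (j % 2 ≡ᵇ p % 2) ∧ R
    ≡⟨ cong ((p ≤ᵇ j) ∧_) (sym (∧-assoc (j ≤ᵇ p + 2 * suc c) _ R)) ⟩
  (p ≤ᵇ j) ∧ ((j ≤ᵇ p + 2 * suc c) ∧ (j % 2 ≡ᵇ p % 2)) ∧ R
    ≡⟨ sym (∧-assoc (p ≤ᵇ j) _ R) ⟩
  ((p ≤ᵇ j) ∧ (j ≤ᵇ p + 2 * suc c) ∧ (j % 2 ≡ᵇ p % 2)) ∧ R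
    ≡⟨ cong (_∧ R) (parityRange≡everyOther p (suc c) j) ⟩
  everyOther p (2 + c) j ∧ R ∎
  where
  open ≡-Reasoning
  R = (1 ≤ᵇ j) ∧ (j ≤ᵇ s)
  end≡ : ∀ p c → suc p + 2 * c + 1 ≡ p + 2 * suc c
  end≡ = solve-∀

augSet-untruncatedChain : ∀ {s M a c h₁ h₂ h₃ h₄ h₅} → suc (a + 2 * suc c) ≤ s → ∀ j →
  augSet (chain {s} {M} (2 + a) c h₁ h₂ h₃ h₄ h₅) j ≡ oddEdges a (suc c) j
augSet-untruncatedChain {s} {M} {a} {c} {h₁} {h₂} {h₃} {h₄} {h₅} last≤s j =
  trans (augSet-chain {s} {M} {suc a} {c} {h₁} {h₂} {h₃} {h₄} {h₅} j)
    (≡-from-⇔ (λ h → proj₁ (∧-true⁻ {oddEdges a (suc c) j} h)) λ j∈ → ∧-true⁺ j∈ (bounds j∈))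
  where
  bounds : j ∈ₑ oddEdges a (suc c) → ((1 ≤ᵇ j) ∧ (j ≤ᵇ s)) ≡ true
  bounds j∈ with ∈-oddEdges⁻ {a} {suc c} {j} j∈
  ... | t , t≤ , j≡ = subst (λ x → ((1 ≤ᵇ x) ∧ (x ≤ᵇ s)) ≡ true) (sym j≡)
    (∧-true⁺ (≤ᵇ-true {1} {suc (a + 2 * t)} (s≤s z≤n))
      (≤ᵇ-true {suc (a + 2 * t)} (≤-trans (s≤s (+-monoʳ-≤ a (*-monoʳ-≤ 2 t≤))) last≤s)))

indicator-mono : ∀ {b c} → (b ≡ true → c ≡ true) → (if b then 1 else 0) ≤ (if c then 1 else 0)
indicator-mono {false} _ = z≤n
indicator-mono {true}  f rewrite f refl = ≤-refl

sizeUpTo-mono : ∀ {X Y} → (∀ {j} → j ∈ₑ X → j ∈ₑ Y) → ∀ n → sizeUpTo X n ≤ sizeUpTo Y n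
sizeUpTo-mono X⊆Y zero    = z≤n
sizeUpTo-mono X⊆Y (suc n) = +-mono-≤ (sizeUpTo-mono X⊆Y n) (indicator-mono X⊆Y)

sizeUpTo-augment : ∀ {M C A M′} → (∀ j → M′ j ≡ ((M j ∧ not (C j)) ∨ A j)) →
  (∀ {j} → j ∈ₑ C → j ∈ₑ M) → (∀ {j} → j ∈ₑ A → j ∉ₑ M) →
  ∀ n → sizeUpTo M′ n + sizeUpTo C n ≡ sizeUpTo M n + sizeUpTo A n
sizeUpTo-augment                 M′≡ C⊆M A∩M zero    = refl
sizeUpTo-augment {M} {C} {A} {M′} M′≡ C⊆M A∩M (suc n) =
  trans (interchange (sizeUpTo M′ n) _ (sizeUpTo C n) _)
    (trans (cong₂ _+_ (sizeUpTo-augment M′≡ C⊆M A∩M n) (pointwise (M (suc n)) (C (suc n)) (A (suc n)) (M′≡ (suc n)) C⊆M A∩M))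
      (interchange (sizeUpTo M n) (sizeUpTo A n) _ _))
  where
  interchange : ∀ a b c d → (a + b) + (c + d) ≡ (a + c) + (b + d)
  interchange = solve-∀
  pointwise : ∀ m c a {m′} → m′ ≡ ((m ∧ not c) ∨ a) → (c ≡ true → m ≡ true) → (a ≡ true → m ≡ false) →
    (if m′ then 1 else 0) + (if c then 1 else 0) ≡ (if m then 1 else 0) + (if a then 1 else 0)
  pointwise true  false false refl _ _ = refl
  pointwise true  true  false refl _ _ = refl
  pointwise false false false refl _ _ = refl
  pointwise false false true  refl _ _ = refl
  pointwise false true  _     refl c⊆ _ with () ← c⊆ refl
  pointwise true  _     true  refl _ a∉ with () ← a∉ refl

sizeUpTo-suc : ∀ X n → sizeUpTo X (suc n) ≡ (if X 1 then 1 else 0) + sizeUpTo (λ j → X (suc j)) n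
sizeUpTo-suc X zero    = +-comm 0 _
sizeUpTo-suc X (suc n) = trans (cong (_+ (if X (suc (suc n)) then 1 else 0)) (sizeUpTo-suc X n)) (+-assoc (if X 1 then 1 else 0) _ _)

sizeUpTo-shiftDown : ∀ {X Y} → 1 ∉ₑ X → (∀ {j} → suc j ∈ₑ X → j ∈ₑ Y) → ∀ n → sizeUpTo X n ≤ sizeUpTo Y n
sizeUpTo-shiftDown             1∉X shift zero    = z≤n
sizeUpTo-shiftDown {X} {Y} 1∉X shift (suc n) rewrite sizeUpTo-suc X n | 1∉X =
  ≤-trans (sizeUpTo-mono shift n) (m≤m+n (sizeUpTo Y n) _)

sizeUpTo-shiftUp : ∀ {X Y} n → suc n ∉ₑ Y → (∀ {j} → j ∈ₑ X → suc j ∈ₑ Y) → sizeUpTo X n ≤ sizeUpTo Y n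
sizeUpTo-shiftUp {X} {Y} n sn∉Y shift = begin
  sizeUpTo X n                                   ≤⟨ sizeUpTo-mono shift n ⟩
  sizeUpTo (λ j → Y (suc j)) n                   ≤⟨ m≤n+m _ (if Y 1 then 1 else 0) ⟩
  (if Y 1 then 1 else 0) + sizeUpTo (λ j → Y (suc j)) n ≡⟨ sym (sizeUpTo-suc Y n) ⟩
  sizeUpTo Y n + (if Y (suc n) then 1 else 0)    ≡⟨ cong (λ b → sizeUpTo Y n + (if b then 1 else 0)) sn∉Y ⟩
  sizeUpTo Y n + 0                               ≡⟨ +-identityʳ _ ⟩
  sizeUpTo Y n                                   ∎
  where open ≤-Reasoning

module _ {s : ℕ} {M : EdgeSet} (M-matching : IsMatching s M) {p c : ℕ} {h₁ : 1 ≤ suc p} {h₂ : suc p + 2 * c ≤ s}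
  {h₃ : ∀ t → t ≤ c → M (suc p + 2 * t) ≡ true} {h₄ : 2 < suc p → M (suc p ∸ 2) ≡ false}
  {h₅ : suc p + 2 * c + 2 ≤ s → M (suc p + 2 * c + 2) ≡ false} where

  private
    C : MaxChain s M
    C = chain (suc p) c h₁ h₂ h₃ h₄ h₅

  ∈-chainSet⁺ : ∀ {t} → t ≤ c → suc p + 2 * t ∈ₑ chainSet C
  ∈-chainSet⁺ {t} t≤c = trans (parityRange≡everyOther (suc p) c _) (∈-everyOther⁺ {suc p} {suc c} {t} (s≤s t≤c))

  ∈-chainSet⁻ : ∀ {j} → j ∈ₑ chainSet C → ∃[ t ] t ≤ c × j ≡ suc p + 2 * t
  ∈-chainSet⁻ {j} j∈ with ∈-everyOther⁻ {suc p} {suc c} {j} (trans (sym (parityRange≡everyOther (suc p) c j)) j∈)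
  ... | t , s≤s t≤c , j≡ = t , t≤c , j≡

  ∈-augSet⁻ : ∀ {j} → j ∈ₑ augSet C → 1 ≤ j × j ≤ s × ∃[ t ] t < 2 + c × j ≡ p + 2 * t
  ∈-augSet⁻ {j} j∈ with ∧-true⁻ {everyOther p (2 + c) j} (trans (sym (augSet-chain {M = M} {h₁ = h₁} {h₂} {h₃} {h₄} {h₅} j)) j∈)
  ... | j∈′ , bounds with ∧-true⁻ {1 ≤ᵇ j} bounds
  ... | 1≤j , j≤s = ≤ᵇ-true⁻ {1} 1≤j , ≤ᵇ-true⁻ {j} j≤s , ∈-everyOther⁻ j∈′

  augPositions∉ : ∀ {t} → t ≤ suc c → p + 2 * t ∉ₑ M
  augPositions∉ {zero}  _           = disjoint⁻ M-matching (h₃ 0 z≤n)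
  augPositions∉ {suc t} (s≤s t≤c) = subst (_∉ₑ M) (sym (+2*suc p t)) (disjoint M-matching (h₃ t t≤c))

  chainSet⊆ : ∀ {j} → j ∈ₑ chainSet C → j ∈ₑ M
  chainSet⊆ j∈ with ∈-chainSet⁻ j∈
  ... | t , t≤c , j≡ = subst (_∈ₑ M) (sym j≡) (h₃ t t≤c)

  augSet∉ : ∀ {j} → j ∈ₑ augSet C → j ∉ₑ M
  augSet∉ j∈ with ∈-augSet⁻ j∈
  ... | _ , _ , t , s≤s t≤c , j≡ = subst (_∉ₑ M) (sym j≡) (augPositions∉ t≤c)

  augSet-larger : ∀ {M′} → (∀ j → M′ j ≡ ((M j ∧ not (chainSet C j)) ∨ augSet C j)) →
    sizeUpTo M′ s ≡ sizeUpTo M s + 1 → sizeUpTo (augSet C) s ≡ suc (sizeUpTo (chainSet C) s)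
  augSet-larger {M′} M′≡ grows = sym (+-cancelˡ-≡ (sizeUpTo M s) _ _ (begin
    sizeUpTo M s + suc (sizeUpTo (chainSet C) s) ≡⟨ +-suc (sizeUpTo M s) _ ⟩
    suc (sizeUpTo M s) + sizeUpTo (chainSet C) s ≡⟨ cong (_+ sizeUpTo (chainSet C) s) (trans (+-comm 1 _) (sym grows)) ⟩
    sizeUpTo M′ s + sizeUpTo (chainSet C) s      ≡⟨ sizeUpTo-augment M′≡ chainSet⊆ augSet∉ s ⟩
    sizeUpTo M s + sizeUpTo (augSet C) s         ∎))
    where open ≡-Reasoning

  -- Shifting by one edge maps a truncated Aug(C) into C.
  truncatedˡ-augSet≤ : p ≡ 0 → sizeUpTo (augSet C) s ≤ sizeUpTo (chainSet C) s
  truncatedˡ-augSet≤ p≡0 = sizeUpTo-shiftDown 1∉aug shift s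
    where
    1∉aug : 1 ∉ₑ augSet C
    1∉aug = ¬-not λ 1∈ → at-1 (∈-augSet⁻ 1∈)
      where
      at-1 : 1 ≤ 1 × 1 ≤ s × ∃[ t ] t < 2 + c × 1 ≡ p + 2 * t → ⊥
      at-1 (_ , _ , zero , _ , 1≡)  = 1+n≢0 (trans 1≡ (trans (+-identityʳ p) p≡0))
      at-1 (_ , _ , suc t , _ , 1≡) = 0≢1+n (suc-injective (trans 1≡ (trans (+2*suc p t) (cong (λ x → 2 + x + 2 * t) p≡0))))
    shift : ∀ {j} → suc j ∈ₑ augSet C → j ∈ₑ chainSet C
    shift sj∈ with ∈-augSet⁻ sj∈
    ... | _ , _ , zero , _ , sj≡ = ⊥-elim (1+n≢0 (trans sj≡ (trans (+-identityʳ p) p≡0)))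
    ... | _ , _ , suc t , s≤s (s≤s t≤c) , sj≡ =
      subst (_∈ₑ chainSet C) (sym (suc-injective (trans sj≡ (+2*suc p t)))) (∈-chainSet⁺ t≤c)

  truncatedʳ-augSet≤ : s ≡ suc p + 2 * c → sizeUpTo (augSet C) s ≤ sizeUpTo (chainSet C) s
  truncatedʳ-augSet≤ s≡ = sizeUpTo-shiftUp s ss∉chain shift
    where
    ss∉chain : suc s ∉ₑ chainSet C
    ss∉chain = ¬-not λ ss∈ → beyond (∈-chainSet⁻ ss∈)
      where
      beyond : ∃[ t ] t ≤ c × suc s ≡ suc p + 2 * t → ⊥
      beyond (t , t≤c , ss≡) =
        <-irrefl refl (≤-trans (≤-reflexive ss≡) (≤-trans (+-monoʳ-≤ (suc p) (*-monoʳ-≤ 2 t≤c)) (≤-reflexive (sym s≡))))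
    shift : ∀ {j} → j ∈ₑ augSet C → suc j ∈ₑ chainSet C
    shift {j} j∈ with ∈-augSet⁻ j∈
    ... | _ , j≤s , t , s≤s t≤sc , j≡ with t ≤? c
    ...   | yes t≤c = subst (_∈ₑ chainSet C) (cong suc (sym j≡)) (∈-chainSet⁺ t≤c)
    ...   | no t≰c  = ⊥-elim (<-irrefl refl (≤-trans (≤-reflexive (cong suc s≡)) (≤-trans (≤-reflexive (sym j≡s+1)) j≤s)))
      where
      j≡s+1 : j ≡ suc (suc p + 2 * c)
      j≡s+1 = trans j≡ (trans (cong (λ u → p + 2 * u) (≤-antisym t≤sc (≰⇒> t≰c))) (+2*suc p c))

  untruncated : ∀ {M′} → (∀ j → M′ j ≡ ((M j ∧ not (chainSet C j)) ∨ augSet C j)) →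
    sizeUpTo M′ s ≡ sizeUpTo M s + 1 → 1 ≤ p × p + 2 * suc c ≤ s
  untruncated M′≡ grows = left , right
    where
    aug≰ : ¬ (sizeUpTo (augSet C) s ≤ sizeUpTo (chainSet C) s)
    aug≰ aug≤ = <-irrefl refl (subst (_≤ sizeUpTo (chainSet C) s) (augSet-larger M′≡ grows) aug≤)
    left : 1 ≤ p
    left with 1 ≤? p
    ... | yes 1≤p = 1≤p
    ... | no 1≰p  = ⊥-elim (aug≰ (truncatedˡ-augSet≤ (n<1⇒n≡0 (≰⇒> 1≰p))))
    right : p + 2 * suc c ≤ s
    right with p + 2 * suc c ≤? s
    ... | yes ≤s = ≤s
    ... | no ≰s  = ⊥-elim (aug≰ (truncatedʳ-augSet≤ (≤-antisym (≤-pred (subst (suc s ≤_) (+2*suc p c) (≰⇒> ≰s))) h₂)))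

chain-end≡ : ∀ a c → 2 + a + 2 * c + 2 ≡ suc (suc (a + 2 * suc c))
chain-end≡ = solve-∀

augmentation→path : ∀ {s M M′} → IsMatching s M → IsAugmentation s M M′ →
  ∃[ a ] ∃[ f ] IsAugmentingPath s M a f × (∀ j → M′ j ≡ augmentAlong M a f j)
augmentation→path {s} {M} M-matching (empty (suc a) _ k≤s h₃ h₄ h₅ , M′≡ , _) =
  a , 0 , path , λ j → trans (M′≡ j) (cong ((M j ∧ true) ∨_) (sym (∨-identityʳ (j ≡ᵇ suc a))))
  where
  a+0≡a : a + 2 * 0 ≡ a
  a+0≡a = +-identityʳ a
  path : IsAugmentingPath s M a 0
  path = record
    { last≤s    = subst (λ x → suc x ≤ s) (sym a+0≡a) k≤s
    ; unmatched = λ { z≤n → subst (λ x → suc x ∉ₑ M) (sym a+0≡a) h₄ }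
    ; matched   = λ ()
    ; exposedˡ  = exposedˡ
    ; exposedʳ  = subst (λ x → suc (suc x) ∉ₑ M) (sym a+0≡a) exposedʳ
    }
    where
    exposedˡ : a ∉ₑ M
    exposedˡ = ∉-from-positive M-matching λ 1≤a → h₃ (s≤s 1≤a)
    exposedʳ : suc (suc a) ∉ₑ M
    exposedʳ = ∉-from-bounded M-matching λ ≤s → subst (_∉ₑ M) (+-comm (suc a) 1) (h₅ (subst (_≤ s) (+-comm 1 (suc a)) ≤s))
augmentation→path {s} {M} {M′} M-matching (chain (suc p) c h₁ h₂ h₃ h₄ h₅ , M′≡ , grows)
  with untruncated M-matching {h₁ = h₁} {h₂} {h₃} {h₄} {h₅} M′≡ grows
... | s≤s {n = a} z≤n , last≤s = a , suc c , path , M′≡augmented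
  where
  M′≡augmented : ∀ j → M′ j ≡ augmentAlong M a (suc c) j
  M′≡augmented j = trans (M′≡ j) (cong₂ (λ x y → (M j ∧ not x) ∨ y) (parityRange≡everyOther (2 + a) c j)
                                       (augSet-untruncatedChain {M = M} {h₁ = h₁} {h₂} {h₃} {h₄} {h₅} last≤s j))
  path : IsAugmentingPath s M a (suc c)
  path = record
    { last≤s    = last≤s
    ; unmatched = augPositions∉ M-matching {h₁ = h₁} {h₂} {h₃} {h₄} {h₅}
    ; matched   = λ { (s≤s t≤c) → h₃ _ t≤c }
    ; exposedˡ  = exposedˡ
    ; exposedʳ  = exposedʳ
    }
    where
    exposedˡ : a ∉ₑ M
    exposedˡ = ∉-from-positive M-matching λ 1≤a → h₄ (s≤s (s≤s 1≤a))
    exposedʳ : suc (suc (a + 2 * suc c)) ∉ₑ M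
    exposedʳ = ∉-from-bounded M-matching λ ≤s →
      subst (_∉ₑ M) (chain-end≡ a c) (h₅ (subst (_≤ s) (sym (chain-end≡ a c)) ≤s))

path→chain : ∀ {s N a f} → IsAugmentingPath s N a f →
  Σ (MaxChain s N) λ C → (∀ j → chainSet C j ≡ evenEdges a f j) × (∀ j → augSet C j ≡ oddEdges a f j)
path→chain {s} {N} {a} {zero} P =
  empty (suc a) (s≤s z≤n) (subst (λ x → suc x ≤ s) a+0≡a last≤s) (λ _ → exposedˡ)
    (subst (λ x → suc x ∉ₑ N) a+0≡a (unmatched z≤n))
    (λ _ → subst (_∉ₑ N) (trans (cong (λ x → suc (suc x)) a+0≡a) (cong suc (+-comm 1 a))) exposedʳ) ,
  (λ j → refl) , λ j → sym (∨-identityʳ (j ≡ᵇ suc a))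
  where
  open IsAugmentingPath P
  a+0≡a : a + 2 * 0 ≡ a
  a+0≡a = +-identityʳ a
path→chain {s} {N} {a} {suc c} P =
  chain (2 + a) c (s≤s z≤n) start≤s covered left right ,
  parityRange≡everyOther (2 + a) c , augSet-untruncatedChain {M = N} {h₁ = s≤s z≤n} {start≤s} {covered} {left} {right} last≤s
  where
  open IsAugmentingPath P
  start≤s : 2 + a + 2 * c ≤ s
  start≤s = ≤-trans (n≤1+n _) (subst (λ x → suc x ≤ s) (+2*suc a c) last≤s)
  covered : ∀ t → t ≤ c → N (2 + a + 2 * t) ≡ true
  covered t t≤c = matched (s≤s t≤c)
  left : 2 < 2 + a → N (2 + a ∸ 2) ≡ false
  left _ = exposedˡ
  right : 2 + a + 2 * c + 2 ≤ s → N (2 + a + 2 * c + 2) ≡ false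
  right _ = subst (_∉ₑ N) (sym (chain-end≡ a c)) exposedʳ

module _ {s : ℕ} {A B : EdgeSet} {a e : ℕ} (P : IsAugmentingPath s A a e) (B≡ : ∀ j → B j ≡ augmentAlong A a e j) where
  open IsAugmentingPath P

  oddEdges⊆B : ∀ {j} → j ∈ₑ oddEdges a e → j ∈ₑ B
  oddEdges⊆B {j} j∈ = trans (B≡ j) (∨-true⁺ʳ {A j ∧ not (evenEdges a e j)} j∈)

  ∈B⁻ : ∀ {j} → j ∈ₑ B → (j ∈ₑ A × j ∉ₑ evenEdges a e) ⊎ j ∈ₑ oddEdges a e
  ∈B⁻ {j} j∈ = ∈-augmentAlong⁻ {A} {a} {e} {j} (trans (sym (B≡ j)) j∈)

  B-agrees-outside : ∀ {j} → j ≤ a ⊎ suc (a + 2 * e) < j → B j ≡ A j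
  B-agrees-outside {j} outside = trans (B≡ j) (augmentAlong-outside {A} {a} {e} outside)

  ∈evenEdges-if-left : ∀ {j} → j ∈ₑ A → j ∉ₑ B → j ∈ₑ evenEdges a e
  ∈evenEdges-if-left {j} j∈A j∉B = ¬-not λ j∉even →
    ∈∉-clash (trans (B≡ j) (∨-true⁺ˡ (∧-true⁺ j∈A (cong not j∉even)))) j∉B

  ∉A-if-next∉odd : ∀ {j} → j ∉ₑ B → suc j ∉ₑ oddEdges a e → j ∉ₑ A
  ∉A-if-next∉odd {j} j∉B sj∉odd =
    ¬-not λ j∈A → ∈∉-clash (evenEdges-next {a} {e} {j} (∈evenEdges-if-left j∈A j∉B)) sj∉odd

  ∉A-if-prev∉odd : ∀ {j} → suc j ∉ₑ B → j ∉ₑ oddEdges a e → suc j ∉ₑ A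
  ∉A-if-prev∉odd {j} sj∉B j∉odd =
    ¬-not λ sj∈A → ∈∉-clash (evenEdges-prev {a} {e} {j} (∈evenEdges-if-left sj∈A sj∉B)) j∉odd

  augmentAlong-isMatching : IsMatching s A → IsMatching s B
  augmentAlong-isMatching A-matching = record { positive = positive′ ; bounded = bounded′ ; disjoint = disjoint′ }
    where
    positive′ : ∀ {j} → j ∈ₑ B → 1 ≤ j
    positive′ j∈ with ∈B⁻ j∈
    ... | inj₁ (j∈A , _) = positive A-matching j∈A
    ... | inj₂ j∈odd     = ≤-trans (s≤s z≤n) (proj₁ (oddEdges-within {a} {e} j∈odd))
    bounded′ : ∀ {j} → j ∈ₑ B → j ≤ s
    bounded′ j∈ with ∈B⁻ j∈
    ... | inj₁ (j∈A , _) = bounded A-matching j∈A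
    ... | inj₂ j∈odd     = ≤-trans (proj₂ (oddEdges-within {a} {e} j∈odd)) last≤s
    adjacent : ∀ {j} → j ∈ₑ B → suc j ∈ₑ B → ⊥
    adjacent {j} j∈ sj∈ with ∈B⁻ j∈ | ∈B⁻ sj∈
    ... | inj₁ (j∈A , _) | inj₁ (sj∈A , _) = ∈∉-clash sj∈A (disjoint A-matching j∈A)
    ... | inj₁ (j∈A , j∉even) | inj₂ sj∈odd with oddEdges-prev {a} {e} {j} sj∈odd
    ...   | inj₁ refl    = ∈∉-clash j∈A exposedˡ
    ...   | inj₂ j∈even  = ∈∉-clash j∈even j∉even
    adjacent {j} j∈ sj∈ | inj₂ j∈odd | inj₁ (sj∈A , sj∉even) with oddEdges-next {a} {e} {j} j∈odd
    ...   | inj₁ sj∈even = ∈∉-clash sj∈even sj∉even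
    ...   | inj₂ refl    = ∈∉-clash sj∈A exposedʳ
    adjacent {j} j∈ sj∈ | inj₂ j∈odd | inj₂ sj∈odd
      with ∈-oddEdges⁻ {a} {e} {j} j∈odd | ∈-oddEdges⁻ {a} {e} {suc j} sj∈odd
    ...   | t , _ , j≡ | u , _ , sj≡ = a+2t≢suc a u t (suc-injective (trans (sym sj≡) (cong suc j≡)))
    disjoint′ : ∀ {j} → j ∈ₑ B → suc j ∉ₑ B
    disjoint′ j∈ = ¬-not (adjacent j∈)

  path-survives : ∀ {b f} → IsAugmentingPath s B b f → (∀ {j} → j ∈ₑ oddEdges a e → j ∉ₑ evenEdges b f) →
    IsAugmentingPath s A b f
  path-survives {b} {f} P′ odd∩even = record
    { last≤s    = P′.last≤s
    ; unmatched = λ {t} t≤f → ∉A-if-next∉odd (P′.unmatched t≤f) (next∉odd t≤f)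
    ; matched   = matched′
    ; exposedˡ  = ∉A-if-next∉odd P′.exposedˡ (∉odd-if-∉B (subst (λ x → suc x ∉ₑ B) (+-identityʳ b) (P′.unmatched z≤n)))
    ; exposedʳ  = ∉A-if-prev∉odd P′.exposedʳ (∉odd-if-∉B (P′.unmatched ≤-refl))
    }
    where
    module P′ = IsAugmentingPath P′
    ∉odd-if-∉B : ∀ {j} → j ∉ₑ B → j ∉ₑ oddEdges a e
    ∉odd-if-∉B j∉B = ¬-not λ j∈odd → ∈∉-clash (oddEdges⊆B j∈odd) j∉B
    ∉odd-if-even : ∀ {j} → j ∈ₑ evenEdges b f → j ∉ₑ oddEdges a e
    ∉odd-if-even j∈even = ¬-not λ j∈odd → ∈∉-clash j∈even (odd∩even j∈odd)
    next∉odd : ∀ {t} → t ≤ f → suc (suc (b + 2 * t)) ∉ₑ oddEdges a e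
    next∉odd {t} t≤f with m≤n⇒m<n∨m≡n t≤f
    ... | inj₁ t<f = ∉odd-if-even (∈-evenEdges⁺ {b} {f} {t} t<f)
    ... | inj₂ refl = ∉odd-if-∉B P′.exposedʳ
    matched′ : ∀ {t} → t < f → suc (suc (b + 2 * t)) ∈ₑ A
    matched′ {t} t<f with ∈B⁻ (P′.matched t<f)
    ... | inj₁ (∈A , _) = ∈A
    ... | inj₂ ∈odd     = ⊥-elim (∈∉-clash ∈odd (∉odd-if-even (∈-evenEdges⁺ {b} {f} {t} t<f)))

  path-starts-before : ∀ {b f t₁ t₂} → IsAugmentingPath s B b f → t₁ ≤ e → a + 2 * t₁ ≡ suc (b + 2 * t₂) →
    ∃[ u ] a ≡ suc (b + 2 * u) × u ≤ t₂
  path-starts-before {b} {f} {t₁} {t₂} P′ t₁≤e meet with t₁ ≤? t₂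
  ... | yes t₁≤t₂ with m≤n⇒∃[o]m+o≡n t₁≤t₂
  ...   | u , refl = u , +-cancelʳ-≡ (2 * t₁) a (suc (b + 2 * u)) (trans meet (shift b u t₁)) , m≤n+m u t₁
    where
    shift : ∀ b u t → suc (b + 2 * (t + u)) ≡ suc (b + 2 * u) + 2 * t
    shift = solve-∀
  path-starts-before {b} {f} {t₁} {t₂} P′ t₁≤e meet | no t₁≰t₂ with m≤n⇒∃[o]m+o≡n (≰⇒> t₁≰t₂)
  ...   | r , refl = ⊥-elim (∈∉-clash (oddEdges⊆B (∈-oddEdges⁺ {a} {e} {r} (≤-trans (m≤n+m r (suc t₂)) t₁≤e)))
                                     (subst (_∉ₑ B) b≡ (IsAugmentingPath.exposedˡ P′)))
    where
    shift : ∀ a t r → a + 2 * (suc t + r) ≡ suc (suc (a + 2 * r)) + 2 * t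
    shift = solve-∀
    b≡ : b ≡ suc (a + 2 * r)
    b≡ = suc-injective (sym (+-cancelʳ-≡ (2 * t₂) _ _ (trans (sym (shift a t₂ r)) meet)))

  path-ends-after : ∀ {b f u} → IsAugmentingPath s B b f → a ≡ suc (b + 2 * u) → u ≤ f → ∃[ v ] f ≡ suc (u + e) + v
  path-ends-after {b} {f} {u} P′ a≡ u≤f with suc (u + e) ≤? f
  ... | yes <f = let (v , eq) = m≤n⇒∃[o]m+o≡n <f in v , sym eq
  ... | no ≮f with m≤n⇒∃[o]m+o≡n u≤f
  ...   | w , refl = ⊥-elim (∈∉-clash (oddEdges⊆B (∈-oddEdges⁺ {a} {e} {w} w≤e))
                                     (subst (_∉ₑ B) end≡ (IsAugmentingPath.exposedʳ P′)))
    where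
    w≤e : w ≤ e
    w≤e = +-cancelˡ-≤ u w e (≤-pred (≰⇒> ≮f))
    shift : ∀ b u w → suc (suc (b + 2 * (u + w))) ≡ suc (suc (b + 2 * u) + 2 * w)
    shift = solve-∀
    end≡ : suc (suc (b + 2 * (u + w))) ≡ suc (a + 2 * w)
    end≡ = trans (shift b u w) (cong (λ x → suc (x + 2 * w)) (sym a≡))

augmentation-isMatching : ∀ {s M M′} → IsMatching s M → IsAugmentation s M M′ → IsMatching s M′
augmentation-isMatching M-matching M→M′ with augmentation→path M-matching M→M′
... | _ , _ , P , M′≡ = augmentAlong-isMatching P M′≡ M-matching

run-isMatching : ∀ {s w M} → IsHARun s w M → ∀ k → k ≤ ⌈ s /2⌉ → IsMatching s (M k)
run-isMatching (M₀≡∅ , _) zero _ = noEdges-isMatching M₀≡∅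
run-isMatching run@(_ , steps) (suc k) k<n =
  augmentation-isMatching (run-isMatching run k (<⇒≤ k<n)) (proj₁ (steps (suc k) (s≤s z≤n) k<n))

augment-twice-disjoint-at : ∀ m c x c′ x′ → (c ≡ true → m ≡ true) → (x ≡ true → m ≡ false) → (x ≡ true → c′ ≡ false) →
  ((((m ∧ not c) ∨ x) ∧ not c′) ∨ x′) ≡ ((m ∧ not (c ∨ c′)) ∨ (x ∨ x′))
augment-twice-disjoint-at false false false c′ x′ _   _   _  = refl
augment-twice-disjoint-at false false true  c′ x′ _   _   x∉ rewrite x∉ refl = refl
augment-twice-disjoint-at true  false false c′ x′ _   _   _  = refl
augment-twice-disjoint-at true  true  false c′ x′ _   _   _  = refl
augment-twice-disjoint-at false true  x     c′ x′ c⊆ _   _  with () ← c⊆ refl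
augment-twice-disjoint-at true  c     true  c′ x′ _   x∉ _  with () ← x∉ refl

augment-twice-nested-at : ∀ m c x c₁ x₁ c₂ x₂ → (c ≡ true → m ≡ true) → (x ≡ true → m ≡ false) → (c ≡ true → (c₁ ∨ c₂) ≡ false) →
  ((((m ∧ not c) ∨ x) ∧ not (c₁ ∨ (x ∨ c₂))) ∨ (x₁ ∨ (c ∨ x₂))) ≡ ((m ∧ not (c₁ ∨ c₂)) ∨ (x₁ ∨ x₂))
augment-twice-nested-at false false false c₁ x₁ c₂ x₂ _  _  _ = refl
augment-twice-nested-at false false true  c₁ x₁ c₂ x₂ _  _  _ rewrite ∨-zeroʳ c₁ = refl
augment-twice-nested-at true  false false c₁ x₁ c₂ x₂ _  _  _ = refl
augment-twice-nested-at true  true  false c₁ x₁ c₂ x₂ _  _  c∉ rewrite c∉ refl | ∨-zeroʳ x₁ = refl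
augment-twice-nested-at false true  x     c₁ x₁ c₂ x₂ c⊆ _  _ with () ← c⊆ refl
augment-twice-nested-at true  c     true  c₁ x₁ c₂ x₂ _  x∉ _ with () ← x∉ refl

path-splits : ∀ {s A B a e b f u v} → IsAugmentingPath s A a e → (∀ j → B j ≡ augmentAlong A a e j) →
  IsAugmentingPath s B b f → a ≡ suc (b + 2 * u) → f ≡ suc (u + e) + v →
  IsAugmentingPath s A b u × IsAugmentingPath s A (suc (a + 2 * e)) v
path-splits {s} {A} {B} {a} {e} {b} {f} {u} {v} P B≡ P′ refl refl = P₁ , P₂
  where
  module P = IsAugmentingPath P
  module P′ = IsAugmentingPath P′
  agreeˡ : ∀ {j} → j ≤ a → A j ≡ B j
  agreeˡ j≤a = sym (B-agrees-outside P B≡ (inj₁ j≤a))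
  agreeʳ : ∀ {j} → suc (a + 2 * e) < j → A j ≡ B j
  agreeʳ <j = sym (B-agrees-outside P B≡ (inj₂ <j))
  u≤f : u ≤ f
  u≤f = ≤-trans (m≤m+n u e) (≤-trans (n≤1+n _) (m≤m+n _ v))
  b+2t<b+2u : ∀ {t} → t < u → suc (b + 2 * t) < b + 2 * u
  b+2t<b+2u {t} t<u = subst (_≤ b + 2 * u) (+2*suc b t) (+-monoʳ-≤ b (*-monoʳ-≤ 2 t<u))
  pos : ∀ b u e t → suc (suc (b + 2 * u) + 2 * e) + 2 * t ≡ b + 2 * (suc (u + e) + t)
  pos = solve-∀
  P₁ : IsAugmentingPath s A b u
  P₁ = record
    { last≤s    = ≤-trans (≤-trans (m≤m+n a (2 * e)) (n≤1+n _)) P.last≤s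
    ; unmatched = λ t≤u → trans (agreeˡ (s≤s (+-monoʳ-≤ b (*-monoʳ-≤ 2 t≤u)))) (P′.unmatched (≤-trans t≤u u≤f))
    ; matched   = λ {t} t<u → trans (agreeˡ (s≤s (≤-trans (n≤1+n _) (b+2t<b+2u t<u)))) (P′.matched (<-≤-trans t<u u≤f))
    ; exposedˡ  = trans (agreeˡ (≤-trans (m≤m+n b (2 * u)) (n≤1+n _))) P′.exposedˡ
    ; exposedʳ  = subst (λ x → suc x ∉ₑ A) (+-identityʳ a) (P.unmatched z≤n)
    }
  P₂ : IsAugmentingPath s A (suc (a + 2 * e)) v
  P₂ = record
    { last≤s    = subst (λ x → suc x ≤ s) (sym (pos b u e v)) P′.last≤s
    ; unmatched = λ {t} t≤v → trans (agreeʳ (s≤s (s≤s (m≤m+n _ (2 * t)))))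
                                    (subst (λ x → suc x ∉ₑ B) (sym (pos b u e t)) (P′.unmatched (+-monoʳ-≤ (suc (u + e)) t≤v)))
    ; matched   = λ {t} t<v → trans (agreeʳ (≤-trans (s≤s (s≤s (m≤m+n _ (2 * t)))) (n≤1+n _)))
                                    (subst (λ x → suc (suc x) ∈ₑ B) (sym (pos b u e t)) (P′.matched (+-monoʳ-< (suc (u + e)) t<v)))
    ; exposedˡ  = P.unmatched ≤-refl
    ; exposedʳ  = trans (agreeʳ (≤-trans (s≤s (s≤s (m≤m+n _ (2 * v)))) (n≤1+n _)))
                        (subst (λ x → suc (suc x) ∉ₑ B) (sym (pos b u e v)) P′.exposedʳ)
    }

record TwoPathAugmentation (s : ℕ) (A C : EdgeSet) : Set where
  field
    {a₁ e₁ a₂ e₂} : ℕ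
    path₁ : IsAugmentingPath s A a₁ e₁
    path₂ : IsAugmentingPath s A a₂ e₂
    result : ∀ j → C j ≡ ((A j ∧ not (evenEdges a₁ e₁ j ∨ evenEdges a₂ e₂ j)) ∨ (oddEdges a₁ e₁ j ∨ oddEdges a₂ e₂ j))

nested-augmentation : ∀ {s A B C a e b f u v} → IsAugmentingPath s A a e →
  (∀ j → B j ≡ augmentAlong A a e j) → IsAugmentingPath s B b f → (∀ j → C j ≡ augmentAlong B b f j) →
  a ≡ suc (b + 2 * u) → f ≡ suc (u + e) + v → TwoPathAugmentation s A C
nested-augmentation {s} {A} {B} {C} {a} {e} {b} {f} {u} {v} P B≡ P′ C≡ refl refl =
  record { a₁ = b ; e₁ = u ; a₂ = r ; e₂ = v ; path₁ = proj₁ split ; path₂ = proj₂ split ; result = result }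
  where
  r = suc (a + 2 * e)
  split : IsAugmentingPath s A b u × IsAugmentingPath s A r v
  split = path-splits P B≡ P′ refl refl
  inner-disjoint : ∀ j → j ∈ₑ evenEdges a e → (evenEdges b u j ∨ evenEdges r v j) ≡ false
  inner-disjoint j j∈ = ¬-not λ j∈′ → case (∨-true⁻ {evenEdges b u j} {evenEdges r v j} j∈′)
    where
    case : j ∈ₑ evenEdges b u ⊎ j ∈ₑ evenEdges r v → ⊥
    case (inj₁ j∈₁) = <-irrefl refl (≤-trans (proj₁ (evenEdges-within {a} {e} j∈)) (proj₂ (evenEdges-within {b} {u} j∈₁)))
    case (inj₂ j∈₂) = <-irrefl refl (≤-trans (proj₁ (evenEdges-within {r} {v} j∈₂)) (proj₂ (evenEdges-within {a} {e} j∈)))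
  result : ∀ j → C j ≡ ((A j ∧ not (evenEdges b u j ∨ evenEdges r v j)) ∨ (oddEdges b u j ∨ oddEdges r v j))
  result j = begin
    C j
      ≡⟨ C≡ j ⟩
    (B j ∧ not (evenEdges b f j)) ∨ oddEdges b f j
      ≡⟨ cong₂ (λ x y → (x ∧ not y) ∨ oddEdges b f j) (B≡ j) (evenEdges-concat b u e v j) ⟩
    (((A j ∧ not (evenEdges a e j)) ∨ oddEdges a e j) ∧ not (evenEdges b u j ∨ (oddEdges a e j ∨ evenEdges r v j))) ∨ oddEdges b f j
      ≡⟨ cong (((A j ∧ not (evenEdges a e j)) ∨ oddEdges a e j) ∧ not (evenEdges b u j ∨ (oddEdges a e j ∨ evenEdges r v j)) ∨_)
              (oddEdges-concat b u e v j) ⟩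
    (((A j ∧ not (evenEdges a e j)) ∨ oddEdges a e j) ∧ not (evenEdges b u j ∨ (oddEdges a e j ∨ evenEdges r v j))) ∨
      (oddEdges b u j ∨ (evenEdges a e j ∨ oddEdges r v j))
      ≡⟨ augment-twice-nested-at (A j) (evenEdges a e j) (oddEdges a e j) (evenEdges b u j) (oddEdges b u j) (evenEdges r v j) (oddEdges r v j)
           (evenEdges⊆ {j = j} P) (oddEdges∉ {j = j} P) (inner-disjoint j) ⟩
    (A j ∧ not (evenEdges b u j ∨ evenEdges r v j)) ∨ (oddEdges b u j ∨ oddEdges r v j) ∎
    where open ≡-Reasoning

augment-twice : ∀ {s A B C a e b f} → IsAugmentingPath s A a e → (∀ j → B j ≡ augmentAlong A a e j) →
  IsAugmentingPath s B b f → (∀ j → C j ≡ augmentAlong B b f j) → TwoPathAugmentation s A C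
augment-twice {s} {A} {B} {C} {a} {e} {b} {f} P B≡ P′ C≡
  with anyUpTo? (λ t → evenEdges b f (suc (a + 2 * t)) Bool.≟ true) (suc e)
... | yes (t₁ , s≤s t₁≤e , hit) with ∈-evenEdges⁻ {b} {f} {suc (a + 2 * t₁)} hit
...   | t₂ , t₂<f , meet with path-starts-before P B≡ P′ t₁≤e (suc-injective meet)
...     | u , a≡ , u≤t₂ with path-ends-after P B≡ P′ a≡ (<⇒≤ (≤-<-trans u≤t₂ t₂<f))
...       | v , f≡ = nested-augmentation {u = u} {v} P B≡ P′ C≡ a≡ f≡
augment-twice {s} {A} {B} {C} {a} {e} {b} {f} P B≡ P′ C≡ | no none =
  record { a₁ = a ; e₁ = e ; a₂ = b ; e₂ = f ; path₁ = P ; path₂ = path-survives P B≡ P′ odd∉even ; result = result }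
  where
  odd∉even : ∀ {j} → j ∈ₑ oddEdges a e → j ∉ₑ evenEdges b f
  odd∉even {j} j∈ with ∈-oddEdges⁻ {a} {e} {j} j∈
  ... | t , t≤e , j≡ = ¬-not λ j∈′ → none (t , s≤s t≤e , subst (_∈ₑ evenEdges b f) j≡ j∈′)
  result : ∀ j → C j ≡ ((A j ∧ not (evenEdges a e j ∨ evenEdges b f j)) ∨ (oddEdges a e j ∨ oddEdges b f j))
  result j = begin
    C j                                             ≡⟨ C≡ j ⟩
    (B j ∧ not (evenEdges b f j)) ∨ oddEdges b f j  ≡⟨ cong (λ x → (x ∧ not (evenEdges b f j)) ∨ oddEdges b f j) (B≡ j) ⟩
    (((A j ∧ not (evenEdges a e j)) ∨ oddEdges a e j) ∧ not (evenEdges b f j)) ∨ oddEdges b f j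
      ≡⟨ augment-twice-disjoint-at (A j) (evenEdges a e j) (oddEdges a e j) (evenEdges b f j) (oddEdges b f j)
           (evenEdges⊆ {j = j} P) (oddEdges∉ {j = j} P) odd∉even ⟩
    (A j ∧ not (evenEdges a e j ∨ evenEdges b f j)) ∨ (oddEdges a e j ∨ oddEdges b f j) ∎
    where open ≡-Reasoning

TwoChainAugmentation : ℕ → EdgeSet → EdgeSet → Set
TwoChainAugmentation s M M″ =
  Σ (MaxChain s M) λ C₁ → Σ (MaxChain s M) λ C₂ →
    ∀ j → M″ j ≡ ((M j ∧ not (chainSet C₁ j ∨ chainSet C₂ j)) ∨ (augSet C₁ j ∨ augSet C₂ j))

twoPaths→twoChains : ∀ {s M M″} → TwoPathAugmentation s M M″ → TwoChainAugmentation s M M″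
twoPaths→twoChains {M = M} T with path→chain (TwoPathAugmentation.path₁ T) | path→chain (TwoPathAugmentation.path₂ T)
... | C₁ , chain₁ , aug₁ | C₂ , chain₂ , aug₂ = C₁ , C₂ , λ j →
  trans (TwoPathAugmentation.result T j)
    (sym (cong₂ (λ x y → (M j ∧ not x) ∨ y) (cong₂ _∨_ (chain₁ j) (chain₂ j)) (cong₂ _∨_ (aug₁ j) (aug₂ j))))

augmentations-compose : ∀ {s M M′ M″} → IsMatching s M → IsAugmentation s M M′ → IsAugmentation s M′ M″ →
  TwoChainAugmentation s M M″
augmentations-compose M-matching M→M′ M′→M″
  with augmentation→path M-matching M→M′ | augmentation-isMatching M-matching M→M′
... | _ , _ , P , M′≡ | M′-matching with augmentation→path M′-matching M′→M″
... | _ , _ , P′ , M″≡ = twoPaths→twoChains (augment-twice P M′≡ P′ M″≡)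

lemma7 : (s : ℕ) (w : Weights) →
    (∀ j → 1 ≤ j → j ≤ s → 1 ≤ w j) →
    (M : ℕ → EdgeSet) → IsHARun s w M →
    (i : ℕ) → i + 2 ≤ ⌈ s /2⌉ →
    Σ (MaxChain s (M i)) λ C₁ → Σ (MaxChain s (M i)) λ C₂ →
    ∀ j → M (i + 2) j ≡
    ((M i j ∧ not (chainSet C₁ j ∨ chainSet C₂ j)) ∨ (augSet C₁ j ∨ augSet C₂ j))
lemma7 s w _ M run@(_ , steps) i i+2≤n =
  subst (λ k → TwoChainAugmentation s (M i) (M k)) (+-comm 2 i)
    (augmentations-compose (run-isMatching run i (≤-trans (m≤m+n i 2) i+2≤n)) (step i i+1≤n) (step (suc i) i+2≤n′))
  where
  i+2≤n′ : suc (suc i) ≤ ⌈ s /2⌉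
  i+2≤n′ = subst (_≤ ⌈ s /2⌉) (+-comm i 2) i+2≤n
  i+1≤n : suc i ≤ ⌈ s /2⌉
  i+1≤n = ≤-trans (n≤1+n _) i+2≤n′
  step : ∀ k → suc k ≤ ⌈ s /2⌉ → IsAugmentation s (M k) (M (suc k))
  step k k<n = proj₁ (steps (suc k) (s≤s z≤n) k<n)
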